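{- Let $n,m,k$ be integers with $n\geq m\geq 1$ and $k\geq 3$. Then $$ gr_{k}(K_{3} : S(n,m))\geq \begin{cases} \max\{5\cdot\frac{n}{2},\,n+2m+1\} + m(k-3)+1 & \text{ if $n$ is even,}\\ \max\{5\cdot\frac{n-1}{2},\,n+2m+1\}+ m(k-3)+ 2 & \text{ if $n$ is odd.} \end{cases} $$
   Context: For integers $n\geq m\geq 0$, the double star $S(n,m)$ is the graph obtained from the disjoint union of the stars $K_{1,n}$ and $K_{1,m}$ by adding an edge between their centers. A coloring of a graph is rainbow if no two edges receive the same color. For a positive integer $k$ and a graph $H$, the Gallai-Ramsey number $gr_k(K_3 : H)$ is the minimum integer $N$ such that every coloring of the edges of the complete graph $K_N$ with (at most) $k$ colors contains either a rainbow triangle or a monochromatic copy of $H$. -}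

module Defs where

open import Data.Nat using (ℕ; _+_; _*_; _∸_; _⊔_; _/_; _≤_)
open import Data.Fin using (Fin)
open import Data.Product using (Σ; _×_; ∃)
open import Data.Sum using (_⊎_)
open import Relation.Binary.PropositionalEquality using (_≡_; _≢_)
open import Relation.Nullary using (¬_)
open import Function.Definitions using (Injective)

-- An edge-colouring of the complete graph K_N with (at most) k colours:
-- a symmetric map on pairs of distinct vertices (diagonal values are irrelevant).
record Coloring (N k : ℕ) : Set where
  field
    col : Fin N → Fin N → Fin k
    sym : ∀ i j → i ≢ j → col i j ≡ col j i
open Coloring public

RainbowTriangle : ∀ {N k} → Coloring N k → Set
RainbowTriangle {N} c =
  Σ (Fin N) λ a → Σ (Fin N) λ b → Σ (Fin N) λ d →
    (a ≢ b) × (b ≢ d) × (a ≢ d) ×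
    (col c a b ≢ col c b d) × (col c b d ≢ col c a d) × (col c a b ≢ col c a d)

data DSVertex (n m : ℕ) : Set where
  cu : DSVertex n m
  cv : DSVertex n m
  lu : Fin n → DSVertex n m
  lv : Fin m → DSVertex n m

data DSEdge {n m : ℕ} : DSVertex n m → DSVertex n m → Set where
  centres : DSEdge cu cv
  leaf-u  : (i : Fin n) → DSEdge cu (lu i)
  leaf-v  : (j : Fin m) → DSEdge cv (lv j)

MonoDoubleStar : ∀ {N k} → Coloring N k → ℕ → ℕ → Set
MonoDoubleStar {N} {k} c n m =
  Σ (DSVertex n m → Fin N) λ f → Σ (Fin k) λ γ →
    Injective _≡_ _≡_ f × (∀ x y → DSEdge x y → col c (f x) (f y) ≡ γ)

GRProperty : ℕ → ℕ → ℕ → ℕ → Set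
GRProperty N k n m =
  (c : Coloring N k) → RainbowTriangle c ⊎ MonoDoubleStar c n m

-- gr_k(K_3 : S(n,m)) ≥ L  iff every N with the Gallai–Ramsey property satisfies L ≤ N
-- (gr is the minimum such N).
GR≥ : ℕ → ℕ → ℕ → ℕ → Set
GR≥ k n m L = ∀ N → GRProperty N k n m → L ≤ N

-- gr_k > s is witnessed by a k-colouring of K_s with no rainbow triangle and no
-- monochromatic S(n,m).  We colour arbitrary vertex types and call a colouring
-- good if it is symmetric, Gallai (every, even degenerate, triangle repeats a
-- colour) and obstructed: for each edge uv of colour γ the closed γ-neighbourhood
-- of u has ≤ n+1 vertices, or that of v has ≤ m+1, or their union has ≤ n+m+1.
-- The file first sets up finite bounds via lists and pigeonhole, enumerations of
-- S(n,m) and the pentagon colouring of K₅; then shows that obstructed colourings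
-- have no monochromatic S(n,m), so a good colouring on s vertices with ≤ k colours
-- gives gr_k ≥ s + 1 (good⇒GR≥).  Adding a block of m vertices in a fresh colour
-- preserves goodness, and two seeds are extended by blocks:
--   (A) one colour on n+m+1 vertices, then k-1 blocks;
--   (B) the pentagon blown up into parts h+e, h, h, h, h (2h+e ≤ n), then k-3 blocks.
-- The theorem is the maximum of both bounds, with h = ⌊n/2⌋ and e ∈ {0, 1}.
module Submission where

open import Defs hiding (sym)
open import Data.Nat using (ℕ; _+_; _*_; _∸_; _⊔_; _/_; _≤_; zero; suc; z≤n; s≤s; s≤s⁻¹; _≤?_; ∣_-_∣)
open import Data.Nat.Divisibility using (_∣_; _∣0)
open import Data.Product using (_×_; Σ; _,_)
open import Relation.Nullary using (¬_; yes; no)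
open import Data.Nat.Properties
  using (≤-refl; ≤-reflexive; ≤-trans; ≰⇒>; 1+n≰n; m≤n⇒m≤1+n; m≤m+n; m≤n+m; +-assoc; +-comm;
         +-identityʳ; +-monoʳ-≤; +-distribʳ-⊔; ⊔-lub; ∣-∣-comm; module ≤-Reasoning)
open import Data.Nat.DivMod using (m/n*n≤m)
open import Data.Nat.Tactic.RingSolver using (solve-∀)
open import Data.Fin using (Fin; zero; suc; toℕ; splitAt; join; _↑ˡ_; _↑ʳ_; inject≤)
open import Data.Fin.Properties using (join-splitAt; inject≤-injective; injective⇒≤; all?; +↔⊎; *↔×)
  renaming (_≟_ to _≟ᶠ_; suc-injective to fin-suc-injective)
open import Data.Sum using (_⊎_; inj₁; inj₂; [_,_]′)
open import Data.Sum.Properties using (inj₂-injective)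
open import Data.Sum.Function.Propositional using (_⊎-↣_)
open import Data.List using (List; []; _∷_; _++_; length; map; filter; allFin; lookup)
open import Data.Nat.ListAction using (sum)
open import Data.List.Properties using (length-++; length-map; length-tabulate)
open import Data.List.Membership.Propositional using (_∈_)
open import Data.List.Membership.Propositional.Properties using (∈-++⁺ˡ; ∈-++⁺ʳ; ∈-map⁺; ∈-allFin; ∈-filter⁺)
open import Data.List.Relation.Unary.Any using (here; there; index)
open import Data.List.Relation.Unary.Any.Properties using (lookup-index)
open import Data.List.Relation.Unary.All using ([]; _∷_)
open import Data.List.Relation.Unary.AllPairs using (_∷_)
open import Data.List.Relation.Unary.Unique.Propositional using (Unique)
open import Data.List.Relation.Unary.Unique.Propositional.Properties using (filter⁺; allFin⁺)
open import Data.Empty using (⊥; ⊥-elim)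
open import Relation.Nullary.Decidable using (toWitness; _⊎-dec_)
open import Relation.Binary.PropositionalEquality
open import Function using (_∘_)
open import Function.Bundles using (_↣_; Injection; mk↣)
open import Function.Construct.Identity using (↣-id)
open import Function.Construct.Composition using (_↣-∘_)
open import Function.Properties.Inverse using (↔⇒↣)
open import Function.Definitions using (Injective)

AtMost : {V : Set} → ℕ → (V → Set) → Set
AtMost {V} b S = Σ (List V) λ xs → length xs ≤ b × (∀ y → S y → y ∈ xs)

atMost-injective : {V : Set} {S : V → Set} {b s : ℕ} → AtMost b S →
  (f : Fin s → V) → Injective _≡_ _≡_ f → (∀ i → S (f i)) → s ≤ b
atMost-injective (xs , len , cover) f f-inj inS = ≤-trans (injective⇒≤ position-inj) len
  where
  position : Fin _ → Fin (length xs)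
  position i = index (cover (f i) (inS i))
  position-inj : Injective _≡_ _≡_ position
  position-inj {i} {j} eq = f-inj (begin
    f i                    ≡⟨ lookup-index (cover (f i) (inS i)) ⟩
    lookup xs (position i) ≡⟨ cong (lookup xs) eq ⟩
    lookup xs (position j) ≡⟨ lookup-index (cover (f j) (inS j)) ⟨
    f j                    ∎)
    where open ≡-Reasoning

atMost-image : {V W : Set} {S : V → Set} {T : W → Set} {b : ℕ} (g : V → W) →
  (∀ z → T z → Σ V λ y → S y × g y ≡ z) → AtMost b S → AtMost b T
atMost-image g preimage (xs , len , cover) =
  map g xs , ≤-trans (≤-reflexive (length-map g xs)) len , covered
  where
  covered : ∀ z → _ → z ∈ map g xs
  covered z t with preimage z t
  ... | y , s , refl = ∈-map⁺ g (cover y s)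

length-allFin : ∀ k → length (allFin k) ≡ k
length-allFin k = length-tabulate (λ i → i)

atMost-weaken : {V : Set} {S : V → Set} {a b : ℕ} → AtMost a S → a ≤ b → AtMost b S
atMost-weaken (xs , len , cover) a≤b = xs , ≤-trans len a≤b , cover

no-room : {V : Set} {S : V → Set} {b : ℕ} → AtMost (suc b) S →
  (f : Fin (2 + b) → V) → Injective _≡_ _≡_ f → (∀ i → S (f i)) → ⊥
no-room small f f-inj inS = 1+n≰n (s≤s⁻¹ (atMost-injective small f f-inj inS))

retraction⇒injective : {A B : Set} (f : A → B) (g : B → A) →
  (∀ a → g (f a) ≡ a) → Injective _≡_ _≡_ f
retraction⇒injective f g gf {a} {a′} eq = trans (sym (gf a)) (trans (cong g eq) (gf a′))

module _ {n m : ℕ} where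

  uSide : Fin (2 + n) → DSVertex n m
  uSide zero          = cu
  uSide (suc zero)    = cv
  uSide (suc (suc i)) = lu i

  uSide-injective : Injective _≡_ _≡_ uSide
  uSide-injective = retraction⇒injective uSide position λ
    { zero → refl ; (suc zero) → refl ; (suc (suc i)) → refl }
    where
    position : DSVertex n m → Fin (2 + n)
    position cu     = zero
    position cv     = suc zero
    position (lu i) = suc (suc i)
    position (lv _) = zero

  vSide : Fin (2 + m) → DSVertex n m
  vSide zero          = cv
  vSide (suc zero)    = cu
  vSide (suc (suc j)) = lv j

  vSide-injective : Injective _≡_ _≡_ vSide
  vSide-injective = retraction⇒injective vSide position λ
    { zero → refl ; (suc zero) → refl ; (suc (suc j)) → refl }
    where
    position : DSVertex n m → Fin (2 + m)
    position cv     = zero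
    position cu     = suc zero
    position (lv j) = suc (suc j)
    position (lu _) = zero

  leaf : Fin n ⊎ Fin m → DSVertex n m
  leaf = [ lu , lv ]′

  allVertices : Fin (2 + (n + m)) → DSVertex n m
  allVertices zero          = cu
  allVertices (suc zero)    = cv
  allVertices (suc (suc i)) = leaf (splitAt n i)

  allVertices-injective : Injective _≡_ _≡_ allVertices
  allVertices-injective = retraction⇒injective allVertices position left-inverse
    where
    position : DSVertex n m → Fin (2 + (n + m))
    position cu     = zero
    position cv     = suc zero
    position (lu i) = suc (suc (i ↑ˡ m))
    position (lv j) = suc (suc (n ↑ʳ j))
    position-leaf : ∀ s → position (leaf s) ≡ suc (suc (join n m s))
    position-leaf (inj₁ _) = refl
    position-leaf (inj₂ _) = refl
    left-inverse : ∀ i → position (allVertices i) ≡ i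
    left-inverse zero          = refl
    left-inverse (suc zero)    = refl
    left-inverse (suc (suc i)) =
      trans (position-leaf (splitAt n i)) (cong (λ j → suc (suc j)) (join-splitAt n m i))

red blue green : Fin 3
red   = zero
blue  = suc zero
green = suc (suc zero)

cyclicClass : ℕ → Fin 3
cyclicClass 0 = green
cyclicClass 1 = red
cyclicClass 4 = red
cyclicClass _ = blue

-- K₅ split into a red and a blue 5-cycle, with green loops.
pentagon : Fin 5 → Fin 5 → Fin 3
pentagon p q = cyclicClass ∣ toℕ p - toℕ q ∣

pentagon-symmetric : ∀ p q → pentagon p q ≡ pentagon q p
pentagon-symmetric p q = cong cyclicClass (∣-∣-comm (toℕ p) (toℕ q))

pentagon-gallai : ∀ p q r →
  pentagon p q ≡ pentagon q r ⊎ pentagon q r ≡ pentagon p r ⊎ pentagon p q ≡ pentagon p r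
pentagon-gallai = toWitness {a? = all? λ p → all? λ q → all? λ r →
  (pentagon p q ≟ᶠ pentagon q r) ⊎-dec (pentagon q r ≟ᶠ pentagon p r) ⊎-dec (pentagon p q ≟ᶠ pentagon p r)} _

neighbourParts : Fin 5 → Fin 3 → List (Fin 5)
neighbourParts p γ = filter (λ q → pentagon p q ≟ᶠ γ) (allFin 5)

neighbourParts-unique : ∀ p γ → Unique (neighbourParts p γ)
neighbourParts-unique p γ = filter⁺ (λ q → pentagon p q ≟ᶠ γ) (allFin⁺ 5)

neighbourParts-few : ∀ p γ → length (neighbourParts p γ) ≤ 2
neighbourParts-few = toWitness {a? = all? λ p → all? λ γ → length (neighbourParts p γ) ≤? 2} _

Nbhd : {V : Set} {K : ℕ} → (V → V → Fin K) → V → Fin K → V → Set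
Nbhd c x γ y = y ≡ x ⊎ c x y ≡ γ

module DoubleStar (n m : ℕ) where

  -- Every edge uv has a side too small to host the corresponding half of S(n,m).
  Obstructed : {V : Set} {K : ℕ} → (V → V → Fin K) → Set
  Obstructed c = ∀ u v → let γ = c u v in
      AtMost (suc n) (Nbhd c u γ)
    ⊎ AtMost (suc m) (Nbhd c v γ)
    ⊎ AtMost (suc (n + m)) (λ y → Nbhd c u γ y ⊎ Nbhd c v γ y)

  -- No injective copy of S(n,m) all of whose edges share the colour of the
  -- central edge: each alternative of `Obstructed` has one vertex too few.
  no-double-star : {V : Set} {K : ℕ} (c : V → V → Fin K) →
    (∀ x y → c x y ≡ c y x) → Obstructed c →
    (F : DSVertex n m → V) → Injective _≡_ _≡_ F →
    (∀ x y → DSEdge x y → c (F x) (F y) ≡ c (F cu) (F cv)) → ⊥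
  no-double-star c symmetric obstructed F F-inj mono
    with obstructed (F cu) (F cv)
  ... | inj₁ small = no-room small (F ∘ uSide) (uSide-injective ∘ F-inj) uSide-in
    where
    uSide-in : ∀ i → Nbhd c (F cu) (c (F cu) (F cv)) (F (uSide i))
    uSide-in zero          = inj₁ refl
    uSide-in (suc zero)    = inj₂ refl
    uSide-in (suc (suc i)) = inj₂ (mono _ _ (leaf-u i))
  ... | inj₂ (inj₁ small) = no-room small (F ∘ vSide) (vSide-injective ∘ F-inj) vSide-in
    where
    vSide-in : ∀ j → Nbhd c (F cv) (c (F cu) (F cv)) (F (vSide j))
    vSide-in zero          = inj₁ refl
    vSide-in (suc zero)    = inj₂ (symmetric _ _)
    vSide-in (suc (suc j)) = inj₂ (mono _ _ (leaf-v j))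
  ... | inj₂ (inj₂ small) = no-room small (F ∘ allVertices) (allVertices-injective ∘ F-inj) all-in
    where
    γ = c (F cu) (F cv)
    leaf-in : ∀ s → Nbhd c (F cu) γ (F (leaf s)) ⊎ Nbhd c (F cv) γ (F (leaf s))
    leaf-in (inj₁ i) = inj₁ (inj₂ (mono _ _ (leaf-u i)))
    leaf-in (inj₂ j) = inj₂ (inj₂ (mono _ _ (leaf-v j)))
    all-in : ∀ i → Nbhd c (F cu) γ (F (allVertices i)) ⊎ Nbhd c (F cv) γ (F (allVertices i))
    all-in zero          = inj₁ (inj₁ refl)
    all-in (suc zero)    = inj₁ (inj₂ refl)
    all-in (suc (suc i)) = leaf-in (splitAt n i)

  record Good (V : Set) (K : ℕ) : Set where
    field
      colour     : V → V → Fin K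
      symmetric  : ∀ x y → colour x y ≡ colour y x
      gallai     : ∀ x y z → colour x y ≡ colour y z ⊎ colour y z ≡ colour x z ⊎ colour x y ≡ colour x z
      obstructed : Obstructed colour

  module Restriction {V : Set} {K k N : ℕ} (G : Good V K) (K≤k : K ≤ k) (embed : Fin N ↣ V) where
    open Good G
    open Injection embed using () renaming (to to vertex; injective to vertex-inj)

    paint : Fin K → Fin k
    paint γ = inject≤ γ K≤k

    restricted : Coloring N k
    restricted = record
      { col = λ i j → paint (colour (vertex i) (vertex j))
      ; sym = λ i j _ → cong paint (symmetric _ _) }

    no-rainbow : ¬ RainbowTriangle restricted
    no-rainbow (a , b , d , _ , _ , _ , ab≢bd , bd≢ad , ab≢ad) with gallai (vertex a) (vertex b) (vertex d)
    ... | inj₁ eq        = ab≢bd (cong paint eq)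
    ... | inj₂ (inj₁ eq) = bd≢ad (cong paint eq)
    ... | inj₂ (inj₂ eq) = ab≢ad (cong paint eq)

    no-star : ¬ MonoDoubleStar restricted n m
    no-star (f , γ , f-inj , edges) =
      no-double-star colour symmetric obstructed (vertex ∘ f) (f-inj ∘ vertex-inj) mono
      where
      mono : ∀ x y → DSEdge x y → colour (vertex (f x)) (vertex (f y)) ≡ colour (vertex (f cu)) (vertex (f cv))
      mono x y e = inject≤-injective K≤k K≤k _ _ (trans (edges x y e) (sym (edges cu cv centres)))

  -- A good colouring with K ≤ k colours on a set containing s vertices shows
  -- gr_k(K₃ : S(n,m)) > s, since it restricts to every K_N with N ≤ s.
  good⇒GR≥ : {V : Set} {K k s : ℕ} → Good V K → K ≤ k → Fin s ↣ V → GR≥ k n m (suc s)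
  good⇒GR≥ {s = s} G K≤k embed N property with N ≤? s
  ... | no N≰s = ≰⇒> N≰s
  ... | yes N≤s = ⊥-elim ([ no-rainbow , no-star ]′ (property restricted))
    where
    open Restriction G K≤k (embed ↣-∘ mk↣ (inject≤-injective N≤s N≤s _ _))

  -- Seed (A): one colour on n + m + 1 vertices.  It is obstructed because any
  -- two centres together see only n + m + 1 vertices.
  clique : Good (Fin (suc (n + m))) 1
  clique = record
    { colour     = λ _ _ → zero
    ; symmetric  = λ _ _ → refl
    ; gallai     = λ _ _ _ → inj₁ refl
    ; obstructed = λ _ _ → inj₂ (inj₂ (allFin _ , ≤-reflexive (length-allFin _) , λ y _ → ∈-allFin y)) }

  module AddBlock {W : Set} {K : ℕ} (m≤n : m ≤ n) (G : Good W (suc K)) where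
    open Good G

    colour′ : Fin m ⊎ W → Fin m ⊎ W → Fin (suc (suc K))
    colour′ (inj₁ _) (inj₁ _) = suc zero
    colour′ (inj₁ _) (inj₂ _) = zero
    colour′ (inj₂ _) (inj₁ _) = zero
    colour′ (inj₂ x) (inj₂ y) = suc (colour x y)

    symmetric′ : ∀ x y → colour′ x y ≡ colour′ y x
    symmetric′ (inj₁ _) (inj₁ _) = refl
    symmetric′ (inj₁ _) (inj₂ _) = refl
    symmetric′ (inj₂ _) (inj₁ _) = refl
    symmetric′ (inj₂ x) (inj₂ y) = cong suc (symmetric x y)

    -- A triangle meeting both the block and the old vertices has two fresh edges.
    gallai′ : ∀ x y z → colour′ x y ≡ colour′ y z ⊎ colour′ y z ≡ colour′ x z ⊎ colour′ x y ≡ colour′ x z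
    gallai′ (inj₁ _) (inj₁ _) (inj₁ _) = inj₁ refl
    gallai′ (inj₁ _) (inj₁ _) (inj₂ _) = inj₂ (inj₁ refl)
    gallai′ (inj₁ _) (inj₂ _) (inj₁ _) = inj₁ refl
    gallai′ (inj₁ _) (inj₂ _) (inj₂ _) = inj₂ (inj₂ refl)
    gallai′ (inj₂ _) (inj₁ _) (inj₁ _) = inj₂ (inj₂ refl)
    gallai′ (inj₂ _) (inj₁ _) (inj₂ _) = inj₁ refl
    gallai′ (inj₂ _) (inj₂ _) (inj₁ _) = inj₂ (inj₁ refl)
    gallai′ (inj₂ x) (inj₂ y) (inj₂ z) with gallai x y z
    ... | inj₁ eq        = inj₁ (cong suc eq)
    ... | inj₂ (inj₁ eq) = inj₂ (inj₁ (cong suc eq))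
    ... | inj₂ (inj₂ eq) = inj₂ (inj₂ (cong suc eq))

    block : List (Fin m ⊎ W)
    block = map inj₁ (allFin m)

    block-length : length block ≡ m
    block-length = trans (length-map inj₁ (allFin m)) (length-allFin m)

    inside-block : ∀ i → AtMost m (Nbhd colour′ (inj₁ i) (suc zero))
    inside-block i = block , ≤-reflexive block-length , covered
      where
      covered : ∀ y → Nbhd colour′ (inj₁ i) (suc zero) y → y ∈ block
      covered (inj₁ j) _ = ∈-map⁺ inj₁ (∈-allFin j)
      covered (inj₂ _) (inj₁ ())
      covered (inj₂ _) (inj₂ ())

    fresh-star : ∀ x → AtMost (suc m) (Nbhd colour′ (inj₂ x) zero)
    fresh-star x = inj₂ x ∷ block , s≤s (≤-reflexive block-length) , covered
      where
      covered : ∀ y → Nbhd colour′ (inj₂ x) zero y → y ∈ inj₂ x ∷ block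
      covered (inj₁ j) _         = there (∈-map⁺ inj₁ (∈-allFin j))
      covered (inj₂ _) (inj₁ eq) = here eq
      covered (inj₂ _) (inj₂ ())

    old-nbhd : ∀ {x γ} z → Nbhd colour′ (inj₂ x) (suc γ) z → Σ W λ y → Nbhd colour x γ y × inj₂ y ≡ z
    old-nbhd (inj₁ _) (inj₁ ())
    old-nbhd (inj₁ _) (inj₂ ())
    old-nbhd (inj₂ y) (inj₁ eq) = y , inj₁ (inj₂-injective eq) , refl
    old-nbhd (inj₂ y) (inj₂ eq) = y , inj₂ (fin-suc-injective eq) , refl

    old-nbhd-∪ : ∀ {x x′ γ} z → Nbhd colour′ (inj₂ x) (suc γ) z ⊎ Nbhd colour′ (inj₂ x′) (suc γ) z →
      Σ W λ y → (Nbhd colour x γ y ⊎ Nbhd colour x′ γ y) × inj₂ y ≡ z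
    old-nbhd-∪ z (inj₁ p) with old-nbhd z p
    ... | y , q , eq = y , inj₁ q , eq
    old-nbhd-∪ z (inj₂ p) with old-nbhd z p
    ... | y , q , eq = y , inj₂ q , eq

    -- Edges at the block have a small side; old edges inherit their obstruction.
    obstructed′ : Obstructed colour′
    obstructed′ (inj₁ i) (inj₁ _) = inj₁ (atMost-weaken (inside-block i) (m≤n⇒m≤1+n m≤n))
    obstructed′ (inj₁ _) (inj₂ y) = inj₂ (inj₁ (fresh-star y))
    obstructed′ (inj₂ x) (inj₁ _) = inj₁ (atMost-weaken (fresh-star x) (s≤s m≤n))
    obstructed′ (inj₂ x) (inj₂ y) with obstructed x y
    ... | inj₁ small        = inj₁ (atMost-image inj₂ old-nbhd small)
    ... | inj₂ (inj₁ small) = inj₂ (inj₁ (atMost-image inj₂ old-nbhd small))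
    ... | inj₂ (inj₂ small) = inj₂ (inj₂ (atMost-image inj₂ old-nbhd-∪ small))

    good′ : Good (Fin m ⊎ W) (suc (suc K))
    good′ = record { colour = colour′ ; symmetric = symmetric′ ; gallai = gallai′ ; obstructed = obstructed′ }

  Blocks : Set → ℕ → Set
  Blocks W zero    = W
  Blocks W (suc j) = Fin m ⊎ Blocks W j

  addBlocks : {W : Set} {K : ℕ} → m ≤ n → Good W (suc K) → (j : ℕ) → Good (Blocks W j) (suc (j + K))
  addBlocks m≤n G zero    = G
  addBlocks m≤n G (suc j) = AddBlock.good′ m≤n (addBlocks m≤n G j)

  blocks-embedding : {W : Set} {s : ℕ} → Fin s ↣ W → (j : ℕ) → Fin (j * m + s) ↣ Blocks W j
  blocks-embedding embed zero = embed
  blocks-embedding {W} {s} embed (suc j) =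
    subst (λ a → Fin a ↣ Blocks W (suc j)) (sym (+-assoc m (j * m) s))
      ((↣-id (Fin m) ⊎-↣ blocks-embedding embed j) ↣-∘ ↔⇒↣ +↔⊎)

  -- A
  -- closed neighbourhood lies in its centre plus at most two distinct parts, and
  -- two distinct parts hold at most 2h + e ≤ n vertices, so it is obstructed.
  module Pentagon (h e : ℕ) (fits : h + h + e ≤ n) where
    Vertex : Set
    Vertex = Fin (h + e) ⊎ (Fin 4 × Fin h)

    part : Vertex → Fin 5
    part (inj₁ _)       = zero
    part (inj₂ (q , _)) = suc q

    size : Fin 5 → ℕ
    size zero    = h + e
    size (suc _) = h

    members : Fin 5 → List Vertex
    members zero    = map inj₁ (allFin (h + e))
    members (suc q) = map (λ a → inj₂ (q , a)) (allFin h)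

    members-length : ∀ q → length (members q) ≡ size q
    members-length zero    = trans (length-map _ (allFin (h + e))) (length-allFin (h + e))
    members-length (suc q) = trans (length-map _ (allFin h)) (length-allFin h)

    in-members : ∀ y → y ∈ members (part y)
    in-members (inj₁ a)       = ∈-map⁺ inj₁ (∈-allFin a)
    in-members (inj₂ (q , a)) = ∈-map⁺ (λ b → inj₂ (q , b)) (∈-allFin a)

    inParts : List (Fin 5) → List Vertex
    inParts []       = []
    inParts (q ∷ qs) = members q ++ inParts qs

    inParts-∈ : ∀ {y qs} → part y ∈ qs → y ∈ inParts qs
    inParts-∈ {y} (here refl) = ∈-++⁺ˡ (in-members y)
    inParts-∈ {qs = q ∷ _} (there p) = ∈-++⁺ʳ (members q) (inParts-∈ p)

    inParts-length : ∀ qs → length (inParts qs) ≡ sum (map size qs)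
    inParts-length []       = refl
    inParts-length (q ∷ qs) =
      trans (length-++ (members q)) (cong₂ _+_ (members-length q) (inParts-length qs))

    one-part : ∀ q → size q ≤ n
    one-part zero    = ≤-trans (m≤n+m (h + e) h) (≤-trans (≤-reflexive (sym (+-assoc h h e))) fits)
    one-part (suc _) = ≤-trans (m≤m+n h h) (≤-trans (m≤m+n (h + h) e) fits)

    two-parts : ∀ q r → q ≢ r → size q + size r ≤ n
    two-parts zero    zero    q≢r = ⊥-elim (q≢r refl)
    two-parts zero    (suc _) _   = ≤-trans (≤-reflexive (trans (+-comm (h + e) h) (sym (+-assoc h h e)))) fits
    two-parts (suc _) zero    _   = ≤-trans (≤-reflexive (sym (+-assoc h h e))) fits
    two-parts (suc _) (suc _) _   = ≤-trans (m≤m+n (h + h) e) fits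

    few-parts : ∀ qs → Unique qs → length qs ≤ 2 → sum (map size qs) ≤ n
    few-parts []                _                     _ = z≤n
    few-parts (q ∷ [])          _                     _ = ≤-trans (≤-reflexive (+-identityʳ (size q))) (one-part q)
    few-parts (q ∷ r ∷ [])      ((q≢r ∷ []) ∷ _)      _ =
      ≤-trans (≤-reflexive (cong (size q +_) (+-identityʳ (size r)))) (two-parts q r q≢r)
    few-parts (_ ∷ _ ∷ _ ∷ _)   _ (s≤s (s≤s ()))

    colour : Vertex → Vertex → Fin 3
    colour x y = pentagon (part x) (part y)

    nbhd-small : ∀ x γ → AtMost (suc n) (Nbhd colour x γ)
    nbhd-small x γ = x ∷ inParts parts , s≤s bound , covered
      where
      parts = neighbourParts (part x) γ
      bound : length (inParts parts) ≤ n
      bound = ≤-trans (≤-reflexive (inParts-length parts))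
                (few-parts parts (neighbourParts-unique (part x) γ) (neighbourParts-few (part x) γ))
      covered : ∀ y → Nbhd colour x γ y → y ∈ x ∷ inParts parts
      covered y (inj₁ eq) = here eq
      covered y (inj₂ eq) = there (inParts-∈ (∈-filter⁺ (λ q → pentagon (part x) q ≟ᶠ γ) (∈-allFin (part y)) eq))

    good : Good Vertex 3
    good = record
      { colour     = colour
      ; symmetric  = λ x y → pentagon-symmetric (part x) (part y)
      ; gallai     = λ x y z → pentagon-gallai (part x) (part y) (part z)
      ; obstructed = λ u v → inj₁ (nbhd-small u (colour u v)) }

    embedding : Fin (h + e + 4 * h) ↣ Vertex
    embedding = (↣-id (Fin (h + e)) ⊎-↣ ↔⇒↣ *↔×) ↣-∘ ↔⇒↣ +↔⊎

GR≥-max : ∀ {k n m A B} a b t d → a + t + d ≤ A → b + t + d ≤ B →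
  GR≥ k n m A → GR≥ k n m B → GR≥ k n m ((a ⊔ b) + t + d)
GR≥-max a b t d a≤A b≤B grA grB N property = begin
  (a ⊔ b) + t + d           ≡⟨ cong (_+ d) (+-distribʳ-⊔ t a b) ⟩
  ((a + t) ⊔ (b + t)) + d   ≡⟨ +-distribʳ-⊔ d (a + t) (b + t) ⟩
  (a + t + d) ⊔ (b + t + d) ≤⟨ ⊔-lub (≤-trans a≤A (grA N property)) (≤-trans b≤B (grB N property)) ⟩
  N                         ∎
  where open ≤-Reasoning

double : ∀ x → x + x ≡ x * 2
double = solve-∀

halves≤ : ∀ a → a / 2 + a / 2 ≤ a
halves≤ a = ≤-trans (≤-reflexive (double (a / 2))) (m/n*n≤m a 2)

odd-halves≤ : ∀ n → ¬ (2 ∣ n) → (n ∸ 1) / 2 + (n ∸ 1) / 2 + 1 ≤ n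
odd-halves≤ zero    odd = ⊥-elim (odd (2 ∣0))
odd-halves≤ (suc a) _   = ≤-trans (≤-reflexive (+-comm (a / 2 + a / 2) 1)) (s≤s (halves≤ a))

cliqueSize : ∀ n m j → suc ((2 + j) * m + suc (n + m)) ≡ n + 2 * m + 1 + m * j + (1 + m)
cliqueSize = solve-∀

pentagonSize : ∀ h e m j → suc (j * m + (h + e + 4 * h)) ≡ 5 * h + m * j + (1 + e)
pentagonSize = solve-∀

proposition3 : (n m k : ℕ) → 1 ≤ m → m ≤ n → 3 ≤ k →
    ((2 ∣ n) → GR≥ k n m (((5 * (n / 2)) ⊔ (n + 2 * m + 1)) + m * (k ∸ 3) + 1))
    × ((¬ (2 ∣ n)) → GR≥ k n m (((5 * ((n ∸ 1) / 2)) ⊔ (n + 2 * m + 1)) + m * (k ∸ 3) + 2))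
proposition3 n m (suc (suc (suc j))) 1≤m m≤n (s≤s (s≤s (s≤s _))) = even , odd
  where
  open DoubleStar n m
  b = n + 2 * m + 1

  boundA : GR≥ (3 + j) n m (b + m * j + (1 + m))
  boundA = subst (GR≥ (3 + j) n m) (cliqueSize n m j)
    (good⇒GR≥ (addBlocks m≤n clique (2 + j)) (s≤s (s≤s (s≤s (≤-reflexive (+-identityʳ j)))))
              (blocks-embedding (↣-id _) (2 + j)))

  boundB : ∀ h e → h + h + e ≤ n → GR≥ (3 + j) n m (5 * h + m * j + (1 + e))
  boundB h e fits = subst (GR≥ (3 + j) n m) (pentagonSize h e m j)
    (good⇒GR≥ (addBlocks m≤n (Pentagon.good h e fits) j) (≤-reflexive (cong suc (+-comm j 2)))
              (blocks-embedding (Pentagon.embedding h e fits) j))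

  -- Parity only matters through e: for even n take e = 0, for odd n take e = 1.
  even : 2 ∣ n → GR≥ (3 + j) n m (((5 * (n / 2)) ⊔ b) + m * j + 1)
  even _ = GR≥-max (5 * (n / 2)) b (m * j) 1 ≤-refl (+-monoʳ-≤ (b + m * j) (s≤s z≤n))
    (boundB (n / 2) 0 (≤-trans (≤-reflexive (+-identityʳ _)) (halves≤ n))) boundA

  odd : ¬ (2 ∣ n) → GR≥ (3 + j) n m (((5 * ((n ∸ 1) / 2)) ⊔ b) + m * j + 2)
  odd n-odd = GR≥-max (5 * ((n ∸ 1) / 2)) b (m * j) 2 ≤-refl (+-monoʳ-≤ (b + m * j) (s≤s 1≤m))
    (boundB ((n ∸ 1) / 2) 1 (odd-halves≤ n n-odd)) boundA
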